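{- A position $(n_0,\dots,n_7)$ of ${\rm ECN}(8_{\{1,3\}},6)$ is a $\mathcal{P}$-position if and only if $n_0=n_2=n_4=n_6$ and $n_1=n_3=n_5=n_7$.
   Context: Extended circular nim ${\rm ECN}(m_S,k)$ (positive integers $k\le m$, $S$ a set of positive integers each at most $m/2$): there are $m$ piles $v_0,\dots,v_{m-1}$ arranged in a circle (indices mod $m$); a position is a tuple $(n_0,\dots,n_{m-1})$ of nonnegative integers, $n_i$ being the number of tokens on $v_i$. A move chooses $s\in S$, $i\in\{0,\dots,m-1\}$, $j\in\{0,\dots,k-1\}$ and removes an arbitrary nonnegative number of tokens from each pile $v_{(i+ts)\bmod m}$, $t=0,\dots,j$, removing at least one token in total (empty piles still count as piles). Normal play: the player unable to move loses. A $\mathcal{P}$-position is a position from which the previous player (the player who just moved) has a winning strategy. -}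

module Defs where

open import Data.Nat using (ℕ; zero; suc; _+_; _*_; _≤_; _<_; NonZero)
open import Data.Nat.DivMod using (_%_)
open import Data.Fin using (Fin; toℕ)
open import Data.List using (List)
open import Data.List.Membership.Propositional using (_∈_)
open import Data.Product using (Σ; _×_; ∃; ∃-syntax)
open import Relation.Binary.PropositionalEquality using (_≡_)
open import Relation.Nullary using (¬_)

Position : ℕ → Set
Position m = Fin m → ℕ

Affected : (m : ℕ) → .{{NonZero m}} → (s : ℕ) → Fin m → (j : ℕ) → Fin m → Set
Affected m s i j l = ∃[ t ] (t ≤ j × toℕ l ≡ (toℕ i + t * s) % m)

record Move (m : ℕ) .{{_ : NonZero m}} (S : List ℕ) (k : ℕ)
            (p q : Position m) : Set where
  field
    s         : ℕ
    s∈S       : s ∈ S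
    i         : Fin m
    j         : ℕ
    j<k       : j < k
    unchanged : ∀ l → ¬ Affected m s i j l → q l ≡ p l
    removes   : ∀ l → q l ≤ p l
    nonempty  : ∃[ l ] (q l < p l)

-- Normal play outcome classes, defined inductively (the game is finite,
-- since every move strictly decreases the total number of tokens).
mutual
  data IsP (m : ℕ) .{{_ : NonZero m}} (S : List ℕ) (k : ℕ) (p : Position m) : Set where
    pPos : (∀ q → Move m S k p q → IsN m S k q) → IsP m S k p

  data IsN (m : ℕ) .{{_ : NonZero m}} (S : List ℕ) (k : ℕ) (p : Position m) : Set where
    nPos : (q : Position m) → Move m S k p q → IsP m S k q → IsN m S k p

{-# OPTIONS --safe #-}
module Submission where

-- A decidable set of positions that no move stays inside (independent) and that
-- every outside position can move into (absorbing) is exactly the set of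
-- P-positions, by induction on the number of tokens. For ECN(8_{1,3}, 6) the
-- balanced positions form such a set. A move with j = 5 touches the six piles
-- v_{i+ts}, t ≤ 5, and spares v_{i+6s} and v_{i+7s}, which have opposite parity
-- because s is odd; shorter moves touch fewer piles. So no move touches a whole
-- parity class, and a move between balanced positions, which would have to
-- lower a whole class, is impossible. Conversely, every odd residue mod 8 is
-- ±1 or ±3, so for any even pile e and odd pile o one full move of stride 1
-- or 3 spares exactly e and o; choosing them as smallest piles of their
-- classes, that move lowers every pile to the minimum of its class.

open import Defs
open import Data.Nat using (ℕ; zero; suc; _+_; _*_; _≤_; _<_; z≤n; s≤s; NonZero)
open import Data.Nat.Properties
  using (_≟_; anyUpTo?; ≤-pred; ≤-trans; +-mono-≤; +-mono-<-≤; +-mono-≤-<; <-irrefl; ≤∧≢⇒<; +-0-monoid)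
open import Data.Nat.DivMod using (_%_)
open import Data.Nat.Induction using (<-wellFounded)
open import Data.Fin using (Fin; toℕ; combine; remQuot; #_)
open import Data.Fin.Patterns using (0F; 1F; 2F; 3F)
open import Data.Fin.Properties using (any?; all?; ¬∀⟶∃¬; combine-remQuot; remQuot-combine)
  renaming (_≟_ to _≟ᶠ_)
open import Data.List using (List; _∷_; []; allFin)
import Data.List.Relation.Unary.All as All
import Data.List.Relation.Unary.Any as Any
open import Data.List.Relation.Unary.Any using (here; there)
open import Data.List.Membership.Propositional using (_∈_; find)
open import Data.List.Membership.Propositional.Properties using (∈-allFin)
open import Data.List.Extrema.Nat using (argmin; f[argmin]≤f[xs])
open import Data.Product using (_×_; _,_; proj₁; proj₂; ∃-syntax; map₂)
open import Data.Sum using (_⊎_; inj₁; inj₂)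
open import Data.Vec.Functional using (Vector)
open import Data.Empty using (⊥-elim)
open import Function using (_∘_; _on_)
open import Function.Bundles using (_⇔_; mk⇔)
open import Induction.WellFounded using (Acc; acc)
open import Relation.Binary.Construct.On using (wellFounded)
open import Relation.Binary.PropositionalEquality
  using (_≡_; refl; sym; trans; cong; subst; subst₂; module ≡-Reasoning)
open import Relation.Nullary using (Dec; yes; no; ¬_; ¬?)
open import Relation.Nullary.Decidable using (map′; toWitness; _→-dec_; _⊎-dec_; _×-dec_)
open import Relation.Unary using (Decidable)
open import Algebra.Properties.Monoid.Sum +-0-monoid using (sum)

sum-mono-≤ : ∀ {n} {u v : Vector ℕ n} → (∀ l → u l ≤ v l) → sum u ≤ sum v
sum-mono-≤ {zero}  _   = z≤n
sum-mono-≤ {suc n} u≤v = +-mono-≤ (u≤v 0F) (sum-mono-≤ (u≤v ∘ Fin.suc))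

sum-mono-< : ∀ {n} {u v : Vector ℕ n} → (∀ l → u l ≤ v l) → ∀ l → u l < v l → sum u < sum v
sum-mono-< u≤v 0F          ul<vl = +-mono-<-≤ ul<vl (sum-mono-≤ (u≤v ∘ Fin.suc))
sum-mono-< u≤v (Fin.suc l) ul<vl = +-mono-≤-< (u≤v 0F) (sum-mono-< (u≤v ∘ Fin.suc) l ul<vl)

module _ {m : ℕ} .{{_ : NonZero m}} where

  affected? : ∀ s i j l → Dec (Affected m s i j l)
  affected? s i j l =
    map′ (λ (t , t<1+j , eq) → t , ≤-pred t<1+j , eq) (λ (t , t≤j , eq) → t , s≤s t≤j , eq)
         (anyUpTo? (λ t → toℕ l ≟ (toℕ i + t * s) % m) (suc j))

  Affected-mono : ∀ {s i j j′ l} → j ≤ j′ → Affected m s i j l → Affected m s i j′ l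
  Affected-mono j≤j′ (t , t≤j , eq) = t , ≤-trans t≤j j≤j′ , eq

  module _ {S : List ℕ} {k : ℕ} where

    Move⇒sum< : ∀ {p q} → Move m S k p q → sum q < sum p
    Move⇒sum< mv = sum-mono-< removes (proj₁ nonempty) (proj₂ nonempty)
      where open Move mv

    IsP⇒¬IsN : ∀ {p} → IsP m S k p → ¬ IsN m S k p
    IsP⇒¬IsN (pPos toN) (nPos q mv isP) = IsP⇒¬IsN isP (toN q mv)

    module Kernel (K : Position m → Set) (K? : Decidable K)
                  (independent : ∀ {p q} → Move m S k p q → K p → ¬ K q)
                  (absorbing : ∀ {p} → ¬ K p → ∃[ q ] Move m S k p q × K q) where

      mutual
        K⇒IsP : ∀ {p} → Acc (_<_ on sum) p → K p → IsP m S k p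
        K⇒IsP (acc rec) Kp =
          pPos λ q mv → ¬K⇒IsN (rec (Move⇒sum< mv)) (independent mv Kp)

        ¬K⇒IsN : ∀ {p} → Acc (_<_ on sum) p → ¬ K p → IsN m S k p
        ¬K⇒IsN (acc rec) ¬Kp =
          let q , mv , Kq = absorbing ¬Kp in nPos q mv (K⇒IsP (rec (Move⇒sum< mv)) Kq)

      IsP⇔K : ∀ p → IsP m S k p ⇔ K p
      IsP⇔K p = mk⇔ IsP⇒K (K⇒IsP accessible)
        where
        accessible : Acc (_<_ on sum) p
        accessible = wellFounded sum <-wellFounded p

        IsP⇒K : IsP m S k p → K p
        IsP⇒K isP with K? p
        ... | yes Kp = Kp
        ... | no ¬Kp = ⊥-elim (IsP⇒¬IsN isP (¬K⇒IsN accessible ¬Kp))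

Strides : List ℕ
Strides = 1 ∷ 3 ∷ []

-- pile r c is v_{2r+c}: c is the parity of the pile and r its rank in its parity class.
pile : Fin 4 → Fin 2 → Fin 8
pile = combine

rank : Fin 8 → Fin 4
rank l = proj₁ (remQuot {4} 2 l)

parity : Fin 8 → Fin 2
parity l = proj₂ (remQuot {4} 2 l)

pile-rank-parity : ∀ l → pile (rank l) (parity l) ≡ l
pile-rank-parity = combine-remQuot {4} 2

parity-pile : ∀ r c → parity (pile r c) ≡ c
parity-pile r c = cong proj₂ (remQuot-combine r c)

spares-each-parity? : ∀ s → Dec (∀ i c → ∃[ r ] ¬ Affected 8 s i 5 (pile r c))
spares-each-parity? s = all? λ i → all? λ c → any? λ r → ¬? (affected? s i 5 (pile r c))

FullMoveSparesOnly : ℕ → Fin 8 → Fin 8 → Fin 8 → Set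
FullMoveSparesOnly s i e o = ∀ l → ¬ Affected 8 s i 5 l → l ≡ e ⊎ l ≡ o

full-move-sparing? : ∀ r₀ r₁ → Dec (Any.Any (λ s → ∃[ i ] FullMoveSparesOnly s i (pile r₀ 0F) (pile r₁ 1F)) Strides)
full-move-sparing? r₀ r₁ = Any.any? (λ s → any? λ i → all? λ l →
  ¬? (affected? s i 5 l) →-dec ((l ≟ᶠ pile r₀ 0F) ⊎-dec (l ≟ᶠ pile r₁ 1F))) Strides

-- Finite checks decided by evaluation; opaque stops the type checker from
-- re-running the decision procedures whenever it unfolds these proofs.
opaque
  full-move-spares-each-parity : ∀ {s} → s ∈ Strides → ∀ i c → ∃[ r ] ¬ Affected 8 s i 5 (pile r c)
  full-move-spares-each-parity (here refl)         = toWitness {a? = spares-each-parity? 1} _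
  full-move-spares-each-parity (there (here refl)) = toWitness {a? = spares-each-parity? 3} _

  full-move-sparing : ∀ r₀ r₁ → ∃[ s ] s ∈ Strides × ∃[ i ] FullMoveSparesOnly s i (pile r₀ 0F) (pile r₁ 1F)
  full-move-sparing r₀ r₁ = find (toWitness {a? = all? λ r₀ → all? (full-move-sparing? r₀)} _ r₀ r₁)

move-spares-each-parity : ∀ {s} → s ∈ Strides → ∀ i {j} → j < 6 → ∀ c → ∃[ r ] ¬ Affected 8 s i j (pile r c)
move-spares-each-parity {s} s∈ i j<6 c =
  map₂ (_∘ Affected-mono {s = s} {i} (≤-pred j<6)) (full-move-spares-each-parity s∈ i c)

Balanced : Position 8 → Set
Balanced p = (p (# 0) ≡ p (# 2) × p (# 2) ≡ p (# 4) × p (# 4) ≡ p (# 6))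
           × (p (# 1) ≡ p (# 3) × p (# 3) ≡ p (# 5) × p (# 5) ≡ p (# 7))

balanced? : Decidable Balanced
balanced? p = ((p (# 0) ≟ p (# 2)) ×-dec (p (# 2) ≟ p (# 4)) ×-dec (p (# 4) ≟ p (# 6)))
       ×-dec ((p (# 1) ≟ p (# 3)) ×-dec (p (# 3) ≟ p (# 5)) ×-dec (p (# 5) ≟ p (# 7)))

balanced-constant-on-parity : ∀ {p} → Balanced p → ∀ l r → p l ≡ p (pile r (parity l))
balanced-constant-on-parity {p} ((e₀₂ , e₂₄ , e₄₆) , (e₁₃ , e₃₅ , e₅₇)) l r = begin
  p l                           ≡⟨ cong p (sym (pile-rank-parity l)) ⟩
  p (pile (rank l) (parity l))  ≡⟨ toFirst (rank l) (parity l) ⟩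
  p (pile 0F (parity l))        ≡⟨ sym (toFirst r (parity l)) ⟩
  p (pile r (parity l))         ∎
  where
  open ≡-Reasoning
  toFirst : ∀ r c → p (pile r c) ≡ p (pile 0F c)
  toFirst 0F _  = refl
  toFirst 1F 0F = sym e₀₂
  toFirst 2F 0F = sym (trans e₀₂ e₂₄)
  toFirst 3F 0F = sym (trans e₀₂ (trans e₂₄ e₄₆))
  toFirst 1F 1F = sym e₁₃
  toFirst 2F 1F = sym (trans e₁₃ e₃₅)
  toFirst 3F 1F = sym (trans e₁₃ (trans e₃₅ e₅₇))

balanced-independent : ∀ {p q} → Move 8 Strides 6 p q → Balanced p → ¬ Balanced q
balanced-independent {p} {q} mv bp bq =
  let l , ql<pl = nonempty
      r′ , unaffected = move-spares-each-parity s∈S i j<k (parity l)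
  in <-irrefl (unchanged (pile r′ (parity l)) unaffected)
              (subst₂ _<_ (balanced-constant-on-parity {q} bq l r′)
                          (balanced-constant-on-parity {p} bp l r′) ql<pl)
  where open Move mv

-- Opaque, or unification unfolds argmin over the unknown pile sizes.
opaque
  lowestRank : Position 8 → Fin 2 → Fin 4
  lowestRank p c = argmin (λ r → p (pile r c)) 0F (allFin 4)

  lowestRank-≤ : ∀ (p : Position 8) c r → p (pile (lowestRank p c) c) ≤ p (pile r c)
  lowestRank-≤ p c r = All.lookup (f[argmin]≤f[xs] {f = λ r′ → p (pile r′ c)} 0F (allFin 4)) (∈-allFin r)

level : Position 8 → Position 8
level p l = p (pile (lowestRank p (parity l)) (parity l))

level-≤ : ∀ p l → level p l ≤ p l
level-≤ p l = subst (level p l ≤_) (cong p (pile-rank-parity l)) (lowestRank-≤ p (parity l) (rank l))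

level-pile : ∀ p r c → level p (pile r c) ≡ p (pile (lowestRank p c) c)
level-pile p r c = cong (λ c′ → p (pile (lowestRank p c′) c′)) (parity-pile r c)

level-balanced : ∀ p → Balanced (level p)
level-balanced p = (refl , refl , refl) , (refl , refl , refl)

level-fixed⇒balanced : ∀ {p} → (∀ l → level p l ≡ p l) → Balanced p
level-fixed⇒balanced {p} fixed =
  (tie (# 0) (# 2) refl , tie (# 2) (# 4) refl , tie (# 4) (# 6) refl) ,
  (tie (# 1) (# 3) refl , tie (# 3) (# 5) refl , tie (# 5) (# 7) refl)
  where
  tie : ∀ l l′ → level p l ≡ level p l′ → p l ≡ p l′
  tie l l′ same = trans (sym (fixed l)) (trans same (fixed l′))

levelling-move : ∀ {p} → ¬ Balanced p → Move 8 Strides 6 p (level p)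
levelling-move {p} unbalanced with full-move-sparing (lowestRank p 0F) (lowestRank p 1F)
... | s , s∈Strides , i , sparesOnly = record
  { s         = s
  ; s∈S       = s∈Strides
  ; i         = i
  ; j         = 5
  ; j<k       = s≤s (s≤s (s≤s (s≤s (s≤s (s≤s z≤n)))))
  ; unchanged = unchanged
  ; removes   = level-≤ p
  ; nonempty  = nonempty
  }
  where
  unchanged : ∀ l → ¬ Affected 8 s i 5 l → level p l ≡ p l
  unchanged l unaffected with sparesOnly l unaffected
  ... | inj₁ refl = level-pile p (lowestRank p 0F) 0F
  ... | inj₂ refl = level-pile p (lowestRank p 1F) 1F

  nonempty : ∃[ l ] level p l < p l
  nonempty =
    let l , unfixed = ¬∀⟶∃¬ 8 _ (λ l → level p l ≟ p l) (unbalanced ∘ level-fixed⇒balanced)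
    in l , ≤∧≢⇒< (level-≤ p l) unfixed

mainTheorem11 : (p : Position 8) →
    IsP 8 (1 ∷ 3 ∷ []) 6 p ⇔
      ((p (# 0) ≡ p (# 2) × p (# 2) ≡ p (# 4) × p (# 4) ≡ p (# 6)) × (p (# 1) ≡ p (# 3) × p (# 3) ≡ p (# 5) × p (# 5) ≡ p (# 7)))
mainTheorem11 = IsP⇔K
  where
  open Kernel Balanced balanced? balanced-independent
              (λ {p} unbalanced → level p , levelling-move unbalanced , level-balanced p)
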